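{- Let $D=\{e_1,\dots,e_d\}$ be a set of $d$ elements, let $1\le l\le d$, and let $N_l=\sum_{i=1}^{l}\binom{d}{i}$ be the number of nonempty subsets of $D$ with at most $l$ elements. Suppose $N_l\equiv r\pmod d$ with $1\le r\le d/2$. Then the nonempty subsets of $D$ with at most $l$ elements can be ordered $S_1,\dots,S_{N_l}$ so that $e_j\in S_i$ whenever $1\le j\le d$ and $i\equiv j\pmod d$; $|S_i|\le|S_j|$ whenever $i\le j$; and, writing $R_j=S_{N_l-r+j}$ for $1\le j\le r$ for the last $r$ subsets in the ordering, $e_{j+r}\in R_j$ for $j=1,\dots,r$. -}

module Defs where

open import Data.Nat using (ℕ; zero; suc; _+_)
open import Data.Nat.Combinatorics using (_C_)

N : ℕ → ℕ → ℕ
N d zero = 0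
N d (suc l) = N d l + d C suc l

module Submission where

-- Build S backwards, S_{N-1}, ..., S_0, one block of equal-size subsets at a time, from size l down
-- to size 1. Entry t of this list must contain the residue of N - 1 - t, which drops by one from each
-- entry to the next, just as the elements of a subset of Z_d do when it is rotated down by one. So a
-- block is enumerated greedily along rotation orbits: keep rotating the last subset while the
-- rotation is still unused, and when the orbit closes start a new one at an unused subset, rotated
-- so as to contain the current residue.
-- The last r subsets are the first r entries. They are taken to be A, ρA, ..., ρ^{r-1}A for a start
-- set A of the top block whose first r rotations are distinct, chosen so that they contain the
-- required e_{j+r}: a rotation of {0, ..., l-1} when r < l, of {0} ∪ {r, ..., r+l-2} when r ≥ l;
-- when l = d the top block is the full set alone, followed by rotations of {0, ..., d-2}.

open import Defs
open import Data.Bool.Properties using () renaming (_≟_ to _≟ᵇ_)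
open import Data.Empty using (⊥-elim)
open import Data.Fin as Fin using (Fin; zero; suc; toℕ; fromℕ<; cast; opposite)
open import Data.Fin.Properties
  using (toℕ-injective; toℕ-fromℕ<; toℕ<n; toℕ-cast; opposite-prop; opposite-involutive; cast-involutive;
         <-cmp)
open import Data.Fin.Subset using (Subset; inside; outside; ∣_∣; Nonempty; ⊤)
open import Data.Fin.Subset.Properties using (nonempty?; Empty-unique; ∣⊥∣≡0; x∈p⇒∣p-x∣<∣p∣; ∈⊤)
open import Data.List as List using (List; []; _∷_; [_]; _++_; length; lookup; filter)
open import Data.List.Properties using (filter-all; filter-accept; filter-reject; length-map; length-++; ++-assoc)
open import Data.List.Relation.Unary.Any using (here; there; index)
open import Data.List.Relation.Unary.Any.Properties using (lookup-index)
open import Data.List.Relation.Unary.All as All using (All; []; _∷_)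
import Data.List.Relation.Unary.All.Properties as All
open import Data.List.Relation.Unary.AllPairs using (AllPairs; []; _∷_)
import Data.List.Relation.Unary.AllPairs.Properties as AllPairs
open import Data.List.Relation.Unary.Unique.Propositional using (Unique)
import Data.List.Relation.Unary.Unique.Propositional.Properties as Unique
open import Data.List.Relation.Binary.Permutation.Propositional
  using (_↭_; ↭-refl; ↭-prep; ↭-swap; ↭-trans; ↭-sym; ↭-reflexive; ↭⇒↭ₛ;
         module PermutationReasoning)
open import Data.List.Relation.Binary.Permutation.Propositional.Properties
  using (↭-length; ++⁺; ∈-resp-↭)
open import Data.List.Relation.Binary.Permutation.Setoid.Properties using (Unique-resp-↭)
open import Data.List.Membership.Propositional.Properties
  using (∈-filter⁻; ∈-filter⁺; ∈-lookup; ∈-map⁺; ∈-map⁻; ∈-++⁺ˡ; ∈-++⁺ʳ; ∈-++⁻)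
open import Data.Nat
  using (ℕ; zero; suc; pred; _+_; _*_; _∸_; _≤_; _<_; z≤n; s≤s; s≤s⁻¹; _%_; _/_; NonZero)
open import Data.Nat.Combinatorics using (_C_; nCk+nC[k+1]≡[n+1]C[k+1]; nC1≡n)
open import Data.Nat.DivMod
  using (m%n<n; m%n≤m; m<n⇒m%n≡m; m%n%n≡m%n; n%n≡0; %-distribˡ-+; [m+n]%n≡m%n; [m+kn]%n≡m%n;
         m≡m%n+[m/n]*n)
open import Data.Nat.GeneralisedArithmetic using (iterate)
open import Data.Nat.Properties
  using (+-assoc; +-comm; +-identityʳ; +-monoʳ-≤; +-suc; +-∸-comm; 1+n≰n; <-trans; <-≤-trans; <⇒≤; <⇒≱;
         >⇒≢; [m+n]∸[m+o]≡n∸o; m+[n∸m]≡n; m<m+n; m<n⇒m<1+n; m∸n+n≡m; m≤n+m; m≤n⇒m<n∨m≡n; m≤n⇒m≤1+n;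
         n<1+n; n≤1+n;
         suc-injective; 1+n≢0; 0<1+n; ∸-monoʳ-<; ∸-monoʳ-≤; ≤-refl; ≤-reflexive; ≤-trans; ≮⇒≥; _<?_)
open import Data.Nat.Tactic.RingSolver using (solve-∀)
open import Data.Product using (Σ; ∃; ∃-syntax; _×_; _,_; proj₁; proj₂; map₁; map₂)
open import Data.Sum using (_⊎_; inj₁; inj₂)
open import Data.Vec as Vec using ([]; _∷_; _∷ʳ_; here; there)
open import Data.Vec.Properties using (∷-injectiveʳ; ∷ʳ-injective; lookup⇒[]=; []=⇒lookup; ≡-dec)
open import Function.Base using (_∘_)
open import Function.Definitions using (Injective)
open import Relation.Binary.Definitions using (DecidableEquality; tri<; tri≈; tri>)
open import Relation.Binary.PropositionalEquality
  using (_≡_; _≢_; refl; sym; trans; cong; cong₂; subst; subst₂; ≢-sym; module ≡-Reasoning)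
open import Relation.Binary.PropositionalEquality.Properties using (setoid)
open import Relation.Nullary using (¬_; ¬?; Dec; yes; no; contradiction)

private
  variable
    A : Set

iterate-succ : ∀ (f : A → A) x n → iterate f (f x) n ≡ f (iterate f x n)
iterate-succ f x zero    = refl
iterate-succ f x (suc n) = iterate-succ f (f x) n

iterate-+ : ∀ (f : A → A) x m n → iterate f x (m + n) ≡ iterate f (iterate f x m) n
iterate-+ f x zero    n = refl
iterate-+ f x (suc m) n = iterate-+ f (f x) m n

iterate-comm : ∀ (f : A → A) x m n → iterate f (iterate f x m) n ≡ iterate f (iterate f x n) m
iterate-comm f x m n = begin
  iterate f (iterate f x m) n  ≡⟨ iterate-+ f x m n ⟨
  iterate f x (m + n)          ≡⟨ cong (iterate f x) (+-comm m n) ⟩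
  iterate f x (n + m)          ≡⟨ iterate-+ f x n m ⟩
  iterate f (iterate f x n) m  ∎
  where open ≡-Reasoning

iterate-injective : ∀ {f : A → A} → Injective _≡_ _≡_ f →
                    ∀ n {x y} → iterate f x n ≡ iterate f y n → x ≡ y
iterate-injective f-injective zero    eq = eq
iterate-injective f-injective (suc n) eq = f-injective (iterate-injective f-injective n eq)

pred≡∸suc+ : ∀ {i m} → i < m → m ∸ 1 ≡ m ∸ suc i + i
pred≡∸suc+ {m = suc m} (s≤s i≤m) = sym (m∸n+n≡m i≤m)

m∸[1+[m∸n]+o]≡n∸[1+o] : ∀ {m n} o → n ≤ m → m ∸ suc (m ∸ n + o) ≡ n ∸ suc o
m∸[1+[m∸n]+o]≡n∸[1+o] {m} {n} o n≤m = begin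
  m ∸ suc (m ∸ n + o)            ≡⟨ cong (_∸ suc (m ∸ n + o)) (m∸n+n≡m n≤m) ⟨
  (m ∸ n + n) ∸ suc (m ∸ n + o)  ≡⟨ cong ((m ∸ n + n) ∸_) (+-suc (m ∸ n) o) ⟨
  (m ∸ n + n) ∸ (m ∸ n + suc o)  ≡⟨ [m+n]∸[m+o]≡n∸o (m ∸ n) n (suc o) ⟩
  n ∸ suc o                      ∎
  where open ≡-Reasoning

module _ {R : A → A → Set} where

  AllPairs-fromAll : ∀ {P : A → Set} → (∀ {x y} → P x → P y → R x y) →
                     ∀ {xs} → All P xs → AllPairs R xs
  AllPairs-fromAll R-P []         = []
  AllPairs-fromAll R-P (px ∷ pxs) = All.map (R-P px) pxs ∷ AllPairs-fromAll R-P pxs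

  AllPairs-lookup : ∀ {xs} → AllPairs R xs → ∀ {i j : Fin (length xs)} →
                    i Fin.< j → R (lookup xs i) (lookup xs j)
  AllPairs-lookup (px ∷ pxs) {zero}  {suc j} _         = All.lookup px (∈-lookup j)
  AllPairs-lookup (px ∷ pxs) {suc i} {suc j} (s≤s i<j) = AllPairs-lookup pxs i<j

  AllPairs-lookup-≤ : (∀ {x} → R x x) → ∀ {xs} → AllPairs R xs → ∀ {i j : Fin (length xs)} →
                      toℕ i ≤ toℕ j → R (lookup xs i) (lookup xs j)
  AllPairs-lookup-≤ R-refl pxs {i} {j} i≤j with <-cmp i j
  ... | tri< i<j _    _   = AllPairs-lookup pxs i<j
  ... | tri≈ _   refl _   = R-refl
  ... | tri> _   _    j<i = contradiction i≤j (<⇒≱ j<i)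

Unique-lookup-injective : ∀ {xs : List A} → Unique xs → ∀ {i j} → lookup xs i ≡ lookup xs j → i ≡ j
Unique-lookup-injective u {i} {j} eq with <-cmp i j
... | tri< i<j _   _   = ⊥-elim (AllPairs-lookup u i<j eq)
... | tri≈ _   i≡j _   = i≡j
... | tri> _   _   j<i = ⊥-elim (AllPairs-lookup u j<i (sym eq))

lookup-iterate-++ : ∀ (f : A → A) x q ys {xs} → xs ≡ List.iterate f x q ++ ys →
                    (p : Fin (length xs)) → toℕ p < q → lookup xs p ≡ iterate f x (toℕ p)
lookup-iterate-++ f x (suc q) ys refl zero    _         = refl
lookup-iterate-++ f x (suc q) ys refl (suc p) (s≤s p<q) = lookup-iterate-++ f (f x) q ys refl p p<q

module Removal {X : Set} (_≟_ : DecidableEquality X) where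

  open import Data.List.Membership.Propositional using (_∈_; _∉_)

  _≢?_ : ∀ y x → Dec (y ≢ x)
  y ≢? x = ¬? (y ≟ x)

  infixl 6 _∖_
  _∖_ : List X → X → List X
  R ∖ x = filter (_≢? x) R

  ∈-∖⁻ : ∀ {x y R} → y ∈ R ∖ x → y ∈ R × y ≢ x
  ∈-∖⁻ = ∈-filter⁻ _

  ∈-∖⁺ : ∀ {x y R} → y ∈ R → y ≢ x → y ∈ R ∖ x
  ∈-∖⁺ = ∈-filter⁺ _

  ∉-∖ : ∀ {x} R → x ∉ R ∖ x
  ∉-∖ R x∈R∖x = proj₂ (∈-∖⁻ {R = R} x∈R∖x) refl

  ∖-unique : ∀ {x R} → Unique R → Unique (R ∖ x)
  ∖-unique = Unique.filter⁺ _

  ∖-all : ∀ {P : X → Set} {x R} → All P R → All P (R ∖ x)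
  ∖-all = All.filter⁺ _

  ∖-↭ : ∀ {x R} → Unique R → x ∈ R → R ↭ x ∷ R ∖ x
  ∖-↭ {x} {x ∷ R} (x∉R ∷ _) (here refl) = ↭-prep x (↭-reflexive (sym (begin
    (x ∷ R) ∖ x  ≡⟨ filter-reject (_≢? x) (λ x≢x → x≢x refl) ⟩
    R ∖ x        ≡⟨ filter-all (_≢? x) (All.map ≢-sym x∉R) ⟩
    R            ∎)))
    where open ≡-Reasoning
  ∖-↭ {x} {y ∷ R} (y∉R ∷ u) (there x∈R) = begin
    y ∷ R            ↭⟨ ↭-prep y (∖-↭ u x∈R) ⟩
    y ∷ x ∷ R ∖ x    ↭⟨ ↭-swap y x ↭-refl ⟩
    x ∷ y ∷ R ∖ x    ≡⟨ cong (x ∷_) (filter-accept (_≢? x) (All.lookup y∉R x∈R)) ⟨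
    x ∷ (y ∷ R) ∖ x  ∎
    where open PermutationReasoning

  length-∖ : ∀ {x R} → Unique R → x ∈ R → suc (length (R ∖ x)) ≡ length R
  length-∖ u x∈R = sym (↭-length (∖-↭ u x∈R))

module OrbitWalk
  {X : Set} (_≟_ : DecidableEquality X) (f : X → X) (f-injective : Injective _≡_ _≡_ f)
  {I : Set} (σ : I → I) (P : I → X → Set) (P-step : ∀ {i x} → P i x → P (σ i) (f x))
  (Admissible : X → Set) (entry : I → X → ℕ)
  (P-entry : ∀ i x → Admissible x → P i (iterate f x (entry i x)))
  where

  open Removal _≟_
  open import Data.List.Membership.Propositional using (_∈_; _∉_)
  open import Data.List.Membership.DecPropositional _≟_ using (_∈?_)

  data Chain : I → List X → Set where
    []  : ∀ {i} → Chain i []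
    _∷_ : ∀ {i x xs} → P i x → Chain (σ i) xs → Chain i (x ∷ xs)

  record Enumeration (i : I) (R xs : List X) : Set where
    field
      perm  : xs ↭ R
      chain : Chain i xs

  MapsInto : List X → List X → Set
  MapsInto xs ys = ∀ {x} → x ∈ xs → f x ∈ ys

  Closed : List X → Set
  Closed R = MapsInto R R

  -- The orbit being walked started at s and has reached c; R holds what is still to be emitted.
  OpenOrbit : X → List X → Set
  OpenOrbit c R = ∃[ s ] MapsInto (c ∷ R) (s ∷ R)

  -- The fuel is length R for walk, and
  -- length R ∸ 1 for restart and startFrom, which emit an element before walking on.
  mutual
    walk : ℕ → I → X → List X → List X
    walk zero    i c R = []
    walk (suc n) i c R with f c ∈? R
    ... | yes _ = startFrom n i (f c) R
    ... | no  _ = restart n i R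

    restart : ℕ → I → List X → List X
    restart n i []      = []
    restart n i (h ∷ R) = startFrom n i (iterate f h (entry i h)) (h ∷ R)

    startFrom : ℕ → I → X → List X → List X
    startFrom n i x R = x ∷ walk n (σ i) x (R ∖ x)

  enumerate : I → List X → List X
  enumerate i R = restart (length R ∸ 1) i R

  enumerateFrom : I → X → List X → List X
  enumerateFrom i x R = startFrom (length R ∸ 1) i x R

  iterate-closed : ∀ {R} → Closed R → ∀ m {x} → x ∈ R → iterate f x m ∈ R
  iterate-closed closed zero    x∈R = x∈R
  iterate-closed closed (suc m) x∈R = iterate-closed closed m (closed x∈R)

  closed⇒openOrbit : ∀ {x R} → Closed R → x ∈ R → OpenOrbit x (R ∖ x)
  closed⇒openOrbit {x} {R} closed x∈R = x , λ y∈ → target (closed (source y∈))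
    where
      source : ∀ {y} → y ∈ x ∷ R ∖ x → y ∈ R
      source (here refl) = x∈R
      source (there y∈)  = proj₁ (∈-∖⁻ y∈)
      target : ∀ {z} → z ∈ R → z ∈ x ∷ R ∖ x
      target {z} z∈R with z ≟ x
      ... | yes refl = here refl
      ... | no  z≢x  = there (∈-∖⁺ z∈R z≢x)

  openOrbit-step : ∀ {c R} → c ∉ R → f c ∈ R → OpenOrbit c R → OpenOrbit (f c) (R ∖ f c)
  openOrbit-step {c} {R} c∉R fc∈R (s , maps) = s , λ x∈ → target (source x∈)
    where
      source : ∀ {x} → x ∈ f c ∷ R ∖ f c → x ∈ R
      source (here refl) = fc∈R
      source (there x∈)  = proj₁ (∈-∖⁻ x∈)
      target : ∀ {x} → x ∈ R → f x ∈ s ∷ R ∖ f c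
      target {x} x∈R with maps (there x∈R)
      ... | here fx≡s = here fx≡s
      ... | there fx∈R with f x ≟ f c
      ...   | yes fx≡fc = ⊥-elim (c∉R (subst (_∈ R) (f-injective fx≡fc) x∈R))
      ...   | no  fx≢fc = there (∈-∖⁺ fx∈R fx≢fc)

  openOrbit-close : ∀ {c R} → c ∉ R → f c ∉ R → OpenOrbit c R → Closed R
  openOrbit-close {c} {R} c∉R fc∉R (s , maps) {x} x∈R with maps (there x∈R) | maps (here refl)
  ... | there fx∈R | _          = fx∈R
  ... | here fx≡s  | here fc≡s  = ⊥-elim (c∉R (subst (_∈ R) (f-injective (trans fx≡s (sym fc≡s))) x∈R))
  ... | here _     | there fc∈R = ⊥-elim (fc∉R fc∈R)

  []-enumeration : ∀ {i R} → length R ≡ 0 → Enumeration i R []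
  []-enumeration {R = []} _ = record { perm = ↭-refl ; chain = [] }

  ∷-enumeration : ∀ {i x R xs} → Unique R → x ∈ R → P i x →
                  Enumeration (σ i) (R ∖ x) xs → Enumeration i R (x ∷ xs)
  ∷-enumeration u x∈R Px e = record
    { perm  = ↭-trans (↭-prep _ (Enumeration.perm e)) (↭-sym (∖-↭ u x∈R))
    ; chain = Px ∷ Enumeration.chain e
    }

  ++-enumeration : ∀ {i R R′ xs ys} → Enumeration i R xs → Enumeration (iterate σ i (length xs)) R′ ys →
                   Enumeration i (R ++ R′) (xs ++ ys)
  ++-enumeration e e′ = record
    { perm  = ++⁺ (Enumeration.perm e) (Enumeration.perm e′)
    ; chain = Chain-++ (Enumeration.chain e) (Enumeration.chain e′)
    }
    where
      Chain-++ : ∀ {i xs ys} → Chain i xs → Chain (iterate σ i (length xs)) ys → Chain i (xs ++ ys)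
      Chain-++ []         cys = cys
      Chain-++ (px ∷ cxs) cys = px ∷ Chain-++ cxs cys

  All-enumeration : ∀ {Q : X → Set} {i R xs} → (∀ {x} → x ∈ R → Q x) → Enumeration i R xs → All Q xs
  All-enumeration Q-R e = All.tabulate (Q-R ∘ ∈-resp-↭ (Enumeration.perm e))

  Chain-lookup : ∀ {i xs} → Chain i xs → (k : Fin (length xs)) → P (iterate σ i (toℕ k)) (lookup xs k)
  Chain-lookup (px ∷ _)   zero    = px
  Chain-lookup (_  ∷ cxs) (suc k) = Chain-lookup cxs k

  mutual
    walk-enumerates : ∀ n {i c R} → length R ≡ n → Unique R → All Admissible R →
                      c ∉ R → P i (f c) → OpenOrbit c R → Enumeration i R (walk n i c R)
    walk-enumerates zero    len _ _ _ _ _ = []-enumeration len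
    walk-enumerates (suc n) {c = c} {R} len u adm c∉R Pfc orbit with f c ∈? R
    ... | yes fc∈R = startFrom-enumerates n len u adm fc∈R Pfc (openOrbit-step c∉R fc∈R orbit)
    ... | no  fc∉R = restart-enumerates n len u adm (openOrbit-close c∉R fc∉R orbit)

    restart-enumerates : ∀ n {i R} → length R ≡ suc n → Unique R → All Admissible R → Closed R →
                         Enumeration i R (restart n i R)
    restart-enumerates n {i} {h ∷ R} len u adm closed =
      startFrom-enumerates n len u adm x∈R (P-entry i h (All.head adm)) (closed⇒openOrbit closed x∈R)
      where x∈R = iterate-closed closed (entry i h) (here refl)

    startFrom-enumerates : ∀ n {i x R} → length R ≡ suc n → Unique R → All Admissible R →
                           x ∈ R → P i x → OpenOrbit x (R ∖ x) → Enumeration i R (startFrom n i x R)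
    startFrom-enumerates n {R = R} len u adm x∈R Px orbit =
      ∷-enumeration u x∈R Px (walk-enumerates n (suc-injective (trans (length-∖ u x∈R) len))
                                (∖-unique u) (∖-all adm) (∉-∖ R) (P-step Px) orbit)

  enumerate-enumerates : ∀ {i R} → Unique R → All Admissible R → Closed R → Enumeration i R (enumerate i R)
  enumerate-enumerates {R = []}    _ _   _      = []-enumeration refl
  enumerate-enumerates {R = _ ∷ _} u adm closed = restart-enumerates _ refl u adm closed

  enumerateFrom-enumerates : ∀ {i x R} → Unique R → All Admissible R → Closed R → x ∈ R → P i x →
                             Enumeration i R (enumerateFrom i x R)
  enumerateFrom-enumerates {R = _ ∷ _} u adm closed x∈R Px =
    startFrom-enumerates _ refl u adm x∈R Px (closed⇒openOrbit closed x∈R)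

  walk-prefix : ∀ k n {i c R} → length R ≡ n → Unique R →
                (∀ {t} → t < k → iterate f c (suc t) ∈ R) →
                (∀ {t} → t < k → iterate f c (suc t) ≢ c) →
                ∃[ ys ] walk n i c R ≡ List.iterate f (f c) k ++ ys
  walk-prefix zero    n       _ _ _ _ = _ , refl
  walk-prefix (suc k) zero    {R = []} _ _ unused _ with () ← unused {0} (s≤s z≤n)
  walk-prefix (suc k) (suc n) {c = c} {R} len u unused aperiodic with f c ∈? R
  ... | no  fc∉R = contradiction (unused {0} (s≤s z≤n)) fc∉R
  ... | yes fc∈R =
    let ys , eq = walk-prefix k n (suc-injective (trans (length-∖ u fc∈R) len)) (∖-unique u)
                    (λ t<k → ∈-∖⁺ (unused (s≤s t<k)) (moves t<k)) moves
    in ys , cong (f c ∷_) eq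
    where
      moves : ∀ {t} → t < k → iterate f (f c) (suc t) ≢ f c
      moves {t} t<k eq = aperiodic (m<n⇒m<1+n t<k) (f-injective (trans (sym (iterate-succ f c (suc t))) eq))

  enumerateFrom-prefix : ∀ q {i x R} → Unique R → Closed R → x ∈ R →
                         (∀ {t} → t < q → iterate f x (suc t) ≢ x) →
                         ∃[ ys ] enumerateFrom i x R ≡ List.iterate f x (suc q) ++ ys
  enumerateFrom-prefix q {R = _ ∷ _} u closed x∈R aperiodic =
    let ys , eq = walk-prefix q _ (suc-injective (length-∖ u x∈R)) (∖-unique u)
                    (λ {t} t<q → ∈-∖⁺ (iterate-closed closed (suc t) x∈R) (aperiodic t<q)) aperiodic
    in ys , cong (_ ∷_) eq

module SubsetLists where

  open import Data.List.Membership.Propositional using (_∈_)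

  subsetsOfSize : ℕ → (m : ℕ) → List (Subset m)
  subsetsOfSize zero    zero    = [ [] ]
  subsetsOfSize (suc k) zero    = []
  subsetsOfSize zero    (suc m) = List.map (outside ∷_) (subsetsOfSize zero m)
  subsetsOfSize (suc k) (suc m) =
    List.map (inside ∷_) (subsetsOfSize k m) ++ List.map (outside ∷_) (subsetsOfSize (suc k) m)

  ∈-subsetsOfSize⁻ : ∀ k m {T : Subset m} → T ∈ subsetsOfSize k m → ∣ T ∣ ≡ k
  ∈-subsetsOfSize⁻ zero    zero    (here refl) = refl
  ∈-subsetsOfSize⁻ zero    (suc m) T∈ with _ , T′∈ , refl ← ∈-map⁻ (outside ∷_) T∈ =
    ∈-subsetsOfSize⁻ zero m T′∈
  ∈-subsetsOfSize⁻ (suc k) (suc m) T∈ with ∈-++⁻ (List.map (inside ∷_) (subsetsOfSize k m)) T∈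
  ... | inj₁ T∈₁ with _ , T′∈ , refl ← ∈-map⁻ (inside ∷_) T∈₁  = cong suc (∈-subsetsOfSize⁻ k m T′∈)
  ... | inj₂ T∈₂ with _ , T′∈ , refl ← ∈-map⁻ (outside ∷_) T∈₂ = ∈-subsetsOfSize⁻ (suc k) m T′∈

  ∈-subsetsOfSize⁺ : ∀ {k m} {T : Subset m} → ∣ T ∣ ≡ k → T ∈ subsetsOfSize k m
  ∈-subsetsOfSize⁺ {zero}  {zero}  {[]}          _    = here refl
  ∈-subsetsOfSize⁺ {zero}  {suc m} {outside ∷ T} ∣T∣≡ = ∈-map⁺ (outside ∷_) (∈-subsetsOfSize⁺ ∣T∣≡)
  ∈-subsetsOfSize⁺ {suc k} {suc m} {inside  ∷ T} ∣T∣≡ =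
    ∈-++⁺ˡ (∈-map⁺ (inside ∷_) (∈-subsetsOfSize⁺ (suc-injective ∣T∣≡)))
  ∈-subsetsOfSize⁺ {suc k} {suc m} {outside ∷ T} ∣T∣≡ =
    ∈-++⁺ʳ (List.map (inside ∷_) (subsetsOfSize k m)) (∈-map⁺ (outside ∷_) (∈-subsetsOfSize⁺ ∣T∣≡))

  subsetsOfSize-unique : ∀ k m → Unique (subsetsOfSize k m)
  subsetsOfSize-unique zero    zero    = [] ∷ []
  subsetsOfSize-unique (suc k) zero    = []
  subsetsOfSize-unique zero    (suc m) = Unique.map⁺ ∷-injectiveʳ (subsetsOfSize-unique zero m)
  subsetsOfSize-unique (suc k) (suc m) = Unique.++⁺
    (Unique.map⁺ ∷-injectiveʳ (subsetsOfSize-unique k m))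
    (Unique.map⁺ ∷-injectiveʳ (subsetsOfSize-unique (suc k) m))
    disjoint
    where
      disjoint : ∀ {T} → ¬ (T ∈ List.map (inside ∷_) (subsetsOfSize k m) ×
                            T ∈ List.map (outside ∷_) (subsetsOfSize (suc k) m))
      disjoint (T∈₁ , T∈₂) with _ , _ , refl ← ∈-map⁻ (inside ∷_) T∈₁ | _ , _ , () ← ∈-map⁻ (outside ∷_) T∈₂

  length-subsetsOfSize : ∀ k m → length (subsetsOfSize k m) ≡ m C k
  length-subsetsOfSize zero    zero    = refl
  length-subsetsOfSize (suc k) zero    = refl
  length-subsetsOfSize zero    (suc m) = trans (length-map _ (subsetsOfSize zero m)) (length-subsetsOfSize zero m)
  length-subsetsOfSize (suc k) (suc m) = begin
    length (List.map (inside ∷_) (subsetsOfSize k m) ++ List.map (outside ∷_) (subsetsOfSize (suc k) m))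
      ≡⟨ length-++ (List.map (inside ∷_) (subsetsOfSize k m)) ⟩
    length (List.map (inside ∷_) (subsetsOfSize k m)) + length (List.map (outside ∷_) (subsetsOfSize (suc k) m))
      ≡⟨ cong₂ _+_ (length-map _ (subsetsOfSize k m)) (length-map _ (subsetsOfSize (suc k) m)) ⟩
    length (subsetsOfSize k m) + length (subsetsOfSize (suc k) m)
      ≡⟨ cong₂ _+_ (length-subsetsOfSize k m) (length-subsetsOfSize (suc k) m) ⟩
    m C k + m C suc k
      ≡⟨ nCk+nC[k+1]≡[n+1]C[k+1] m k ⟩
    suc m C suc k
      ∎
    where open ≡-Reasoning

  subsetsOfSize-empty : ∀ {k m} → m < k → subsetsOfSize k m ≡ []
  subsetsOfSize-empty {suc k} {zero}  _         = refl
  subsetsOfSize-empty {suc k} {suc m} (s≤s m<k) =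
    cong₂ (λ xs ys → List.map (inside ∷_) xs ++ List.map (outside ∷_) ys)
      (subsetsOfSize-empty m<k) (subsetsOfSize-empty (m<n⇒m<1+n m<k))

  subsetsOfSize-full : ∀ m → subsetsOfSize m m ≡ [ ⊤ ]
  subsetsOfSize-full zero    = refl
  subsetsOfSize-full (suc m) =
    cong₂ (λ xs ys → List.map (inside ∷_) xs ++ List.map (outside ∷_) ys)
      (subsetsOfSize-full m) (subsetsOfSize-empty (n<1+n m))

  nonemptySubsetsUpTo : ℕ → (m : ℕ) → List (Subset m)
  nonemptySubsetsUpTo zero    m = []
  nonemptySubsetsUpTo (suc k) m = subsetsOfSize (suc k) m ++ nonemptySubsetsUpTo k m

  ∈-nonemptySubsetsUpTo⁻ : ∀ l {m} {T : Subset m} → T ∈ nonemptySubsetsUpTo l m →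
                           0 < ∣ T ∣ × ∣ T ∣ ≤ l
  ∈-nonemptySubsetsUpTo⁻ (suc k) {m} T∈ with ∈-++⁻ (subsetsOfSize (suc k) m) T∈
  ... | inj₁ T∈k = let ∣T∣≡l = ∈-subsetsOfSize⁻ (suc k) m T∈k
                   in ≤-trans (s≤s z≤n) (≤-reflexive (sym ∣T∣≡l)) , ≤-reflexive ∣T∣≡l
  ... | inj₂ T∈< = map₂ m≤n⇒m≤1+n (∈-nonemptySubsetsUpTo⁻ k T∈<)

  ∈-nonemptySubsetsUpTo⁺ : ∀ l {m} {T : Subset m} → 0 < ∣ T ∣ → ∣ T ∣ ≤ l →
                           T ∈ nonemptySubsetsUpTo l m
  ∈-nonemptySubsetsUpTo⁺ zero    0<∣T∣ ∣T∣≤0 = contradiction ∣T∣≤0 (<⇒≱ 0<∣T∣)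
  ∈-nonemptySubsetsUpTo⁺ (suc k) {m} 0<∣T∣ ∣T∣≤l with m≤n⇒m<n∨m≡n ∣T∣≤l
  ... | inj₂ ∣T∣≡l        = ∈-++⁺ˡ (∈-subsetsOfSize⁺ ∣T∣≡l)
  ... | inj₁ (s≤s ∣T∣≤k) =
    ∈-++⁺ʳ (subsetsOfSize (suc k) m) (∈-nonemptySubsetsUpTo⁺ k 0<∣T∣ ∣T∣≤k)

  nonemptySubsetsUpTo-unique : ∀ l m → Unique (nonemptySubsetsUpTo l m)
  nonemptySubsetsUpTo-unique zero    m = []
  nonemptySubsetsUpTo-unique (suc k) m =
    Unique.++⁺ (subsetsOfSize-unique (suc k) m) (nonemptySubsetsUpTo-unique k m) disjoint
    where
      disjoint : ∀ {T} → ¬ (T ∈ subsetsOfSize (suc k) m × T ∈ nonemptySubsetsUpTo k m)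
      disjoint (T∈k , T∈<) =
        1+n≰n (subst (_≤ k) (∈-subsetsOfSize⁻ (suc k) m T∈k) (proj₂ (∈-nonemptySubsetsUpTo⁻ k T∈<)))

  length-nonemptySubsetsUpTo : ∀ l m → length (nonemptySubsetsUpTo l m) ≡ N m l
  length-nonemptySubsetsUpTo zero    m = refl
  length-nonemptySubsetsUpTo (suc k) m = begin
    length (subsetsOfSize (suc k) m ++ nonemptySubsetsUpTo k m)
      ≡⟨ length-++ (subsetsOfSize (suc k) m) ⟩
    length (subsetsOfSize (suc k) m) + length (nonemptySubsetsUpTo k m)
      ≡⟨ cong₂ _+_ (length-subsetsOfSize (suc k) m) (length-nonemptySubsetsUpTo k m) ⟩
    m C suc k + N m k
      ≡⟨ +-comm (m C suc k) (N m k) ⟩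
    N m (suc k)
      ∎
    where open ≡-Reasoning

open SubsetLists

open import Data.Fin.Subset using (_∈_; _∉_)

Nonempty⇒∣p∣>0 : ∀ {m} {p : Subset m} → Nonempty p → 0 < ∣ p ∣
Nonempty⇒∣p∣>0 (_ , x∈p) = <-≤-trans (s≤s z≤n) (x∈p⇒∣p-x∣<∣p∣ x∈p)

∣p∣>0⇒Nonempty : ∀ {m} {p : Subset m} → 0 < ∣ p ∣ → Nonempty p
∣p∣>0⇒Nonempty {m} {p} 0<∣p∣ with nonempty? p
... | yes nonempty = nonempty
... | no  empty    = contradiction (trans (cong ∣_∣ (Empty-unique empty)) (∣⊥∣≡0 m)) (>⇒≢ 0<∣p∣)

interval : ∀ {m} → ℕ → ℕ → Subset m
interval {zero}  _       _       = []
interval {suc m} zero    zero    = outside ∷ interval 0 0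
interval {suc m} zero    (suc w) = inside ∷ interval 0 w
interval {suc m} (suc a) w       = outside ∷ interval a w

∈-interval : ∀ {m a w} (j : Fin m) → a ≤ toℕ j → toℕ j < a + w → j ∈ interval a w
∈-interval {suc m} {zero}  {suc w} zero    _         _           = here
∈-interval {suc m} {zero}  {suc w} (suc j) _         (s≤s j<w)   = there (∈-interval j z≤n j<w)
∈-interval {suc m} {suc a}         (suc j) (s≤s a≤j) (s≤s j<a+w) = there (∈-interval j a≤j j<a+w)

∉-interval : ∀ {m a w} (j : Fin m) → toℕ j < a ⊎ a + w ≤ toℕ j → j ∉ interval a w
∉-interval {suc m} {zero}  {zero}  zero    _                ()
∉-interval {suc m} {zero}  {zero}  (suc j) _                (there j∈) = ∉-interval j (inj₂ z≤n) j∈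
∉-interval {suc m} {zero}  {suc w} (suc j) (inj₂ (s≤s w≤j)) (there j∈) = ∉-interval j (inj₂ w≤j) j∈
∉-interval {suc m} {suc a}         zero    _                ()
∉-interval {suc m} {suc a}         (suc j) (inj₁ (s≤s j<a)) (there j∈) = ∉-interval j (inj₁ j<a) j∈
∉-interval {suc m} {suc a}         (suc j) (inj₂ (s≤s ≤j))  (there j∈) = ∉-interval j (inj₂ ≤j) j∈

∣interval∣ : ∀ {m} a w → a + w ≤ m → ∣ interval {m} a w ∣ ≡ w
∣interval∣ {zero}  zero    zero    _            = refl
∣interval∣ {suc m} zero    zero    _            = ∣interval∣ {m} 0 0 z≤n
∣interval∣ {suc m} zero    (suc w) (s≤s w≤m)    = cong suc (∣interval∣ 0 w w≤m)
∣interval∣ {suc m} (suc a) w       (s≤s a+w≤m) = ∣interval∣ a w a+w≤m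

sucᶜ : ∀ {n} → Fin (suc n) → Fin (suc n)
sucᶜ {zero}  zero    = zero
sucᶜ {suc n} zero    = suc zero
sucᶜ {suc n} (suc j) with sucᶜ {n} j
... | zero  = zero
... | suc k = suc (suc k)

sucᶜ-wraps-or-steps : ∀ {n} (j : Fin (suc n)) →
                      (toℕ j ≡ n × toℕ (sucᶜ j) ≡ 0) ⊎ (toℕ j < n × toℕ (sucᶜ j) ≡ suc (toℕ j))
sucᶜ-wraps-or-steps {zero}  zero    = inj₁ (refl , refl)
sucᶜ-wraps-or-steps {suc n} zero    = inj₂ (s≤s z≤n , refl)
sucᶜ-wraps-or-steps {suc n} (suc j) with sucᶜ j | sucᶜ-wraps-or-steps j
... | zero  | inj₁ (j≡n , _)  = inj₁ (cong suc j≡n , refl)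
... | suc k | inj₂ (j<n , eq) = inj₂ (s≤s j<n , cong suc eq)

toℕ-sucᶜ : ∀ {n} (j : Fin (suc n)) → toℕ (sucᶜ j) ≡ suc (toℕ j) % suc n
toℕ-sucᶜ {n} j with sucᶜ-wraps-or-steps j
... | inj₁ (j≡n , wraps) = trans wraps (sym (trans (cong (λ x → suc x % suc n) j≡n) (n%n≡0 (suc n))))
... | inj₂ (j<n , steps) = trans steps (sym (m<n⇒m%n≡m (s≤s j<n)))

rotate : ∀ {n} → Subset (suc n) → Subset (suc n)
rotate (x ∷ xs) = xs ∷ʳ x

lookup-rotate : ∀ {n} (T : Subset (suc n)) j → Vec.lookup (rotate T) j ≡ Vec.lookup T (sucᶜ j)
lookup-rotate (x ∷ [])     zero    = refl
lookup-rotate (x ∷ y ∷ ys) zero    = refl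
lookup-rotate (x ∷ y ∷ ys) (suc j) with sucᶜ j | lookup-rotate (x ∷ ys) j
... | zero  | eq = eq
... | suc k | eq = eq

∣∷ʳ∣ : ∀ {n} (xs : Subset n) x → ∣ xs ∷ʳ x ∣ ≡ ∣ x ∷ xs ∣
∣∷ʳ∣ []             x       = refl
∣∷ʳ∣ (inside  ∷ xs) inside  = cong suc (∣∷ʳ∣ xs inside)
∣∷ʳ∣ (inside  ∷ xs) outside = cong suc (∣∷ʳ∣ xs outside)
∣∷ʳ∣ (outside ∷ xs) inside  = ∣∷ʳ∣ xs inside
∣∷ʳ∣ (outside ∷ xs) outside = ∣∷ʳ∣ xs outside

∣rotate∣ : ∀ {n} (T : Subset (suc n)) → ∣ rotate T ∣ ≡ ∣ T ∣
∣rotate∣ (x ∷ xs) = ∣∷ʳ∣ xs x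

∣rotate^∣ : ∀ {n} m (T : Subset (suc n)) → ∣ iterate rotate T m ∣ ≡ ∣ T ∣
∣rotate^∣ zero    T = refl
∣rotate^∣ (suc m) T = trans (∣rotate^∣ m (rotate T)) (∣rotate∣ T)

rotate-injective : ∀ {n} → Injective _≡_ _≡_ (rotate {n})
rotate-injective {x = x ∷ xs} {y ∷ ys} eq with refl , refl ← ∷ʳ-injective xs ys eq = refl

module Modulo (n : ℕ) where

  d : ℕ
  d = suc n

  residue : ℕ → Fin d
  residue t = fromℕ< (m%n<n t d)

  toℕ-residue : ∀ t → toℕ (residue t) ≡ t % d
  toℕ-residue t = toℕ-fromℕ< (m%n<n t d)

  residue-cong : ∀ t u → t % d ≡ u % d → residue t ≡ residue u
  residue-cong t u eq = toℕ-injective (trans (toℕ-residue t) (trans eq (sym (toℕ-residue u))))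

  residue-toℕ : ∀ j → residue (toℕ j) ≡ j
  residue-toℕ j = toℕ-injective (trans (toℕ-residue (toℕ j)) (m<n⇒m%n≡m (toℕ<n j)))

  residue-d+ : ∀ t → residue (d + t) ≡ residue t
  residue-d+ t = residue-cong (d + t) t (trans (cong (_% d) (+-comm d t)) ([m+n]%n≡m%n t d))

  toℕ-residue-< : ∀ {t} → t < d → toℕ (residue t) ≡ t
  toℕ-residue-< {t} t<d = trans (toℕ-residue t) (m<n⇒m%n≡m t<d)

  residue-∸ : ∀ m {r} s → m % d ≡ r → s ≤ r → residue (m ∸ s) ≡ residue (r ∸ s)
  residue-∸ m {r} s m%d≡r s≤r = residue-cong (m ∸ s) (r ∸ s) (begin
    (m ∸ s) % d                        ≡⟨ cong (λ x → (x ∸ s) % d) (m≡m%n+[m/n]*n m d) ⟩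
    (m % d + m / d * d ∸ s) % d        ≡⟨ cong (λ x → (x + m / d * d ∸ s) % d) m%d≡r ⟩
    (r + m / d * d ∸ s) % d            ≡⟨ cong (_% d) (+-∸-comm (m / d * d) s≤r) ⟩
    (r ∸ s + m / d * d) % d            ≡⟨ [m+kn]%n≡m%n (r ∸ s) (m / d) d ⟩
    (r ∸ s) % d                        ∎)
    where open ≡-Reasoning

  residue∈interval : ∀ {a w} t → a ≤ t → t < a + w → t < d → residue t ∈ interval a w
  residue∈interval {a} {w} t a≤t t<a+w t<d = ∈-interval (residue t)
    (subst (a ≤_) (sym (toℕ-residue-< t<d)) a≤t) (subst (_< a + w) (sym (toℕ-residue-< t<d)) t<a+w)

  residue∉interval : ∀ {a w} t → t < a ⊎ a + w ≤ t → t < d → residue t ∉ interval a w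
  residue∉interval {a} {w} t beyond t<d =
    ∉-interval (residue t) (subst (λ t → t < a ⊎ a + w ≤ t) (sym (toℕ-residue-< t<d)) beyond)

  residue-suc : ∀ {t} (t<n : t < n) → residue (suc t) ≡ suc (fromℕ< t<n)
  residue-suc t<n = toℕ-injective (trans (toℕ-residue-< (s≤s t<n)) (cong suc (sym (toℕ-fromℕ< t<n))))

  residue-% : ∀ t → residue (t % d) ≡ residue t
  residue-% t = residue-cong (t % d) t (m%n%n≡m%n t d)

  residue-+-toℕ : ∀ k t → residue (k + toℕ (residue t)) ≡ residue (k + t)
  residue-+-toℕ k t = residue-cong (k + toℕ (residue t)) (k + t) (begin
    (k + toℕ (residue t)) % d    ≡⟨ cong (λ x → (k + x) % d) (toℕ-residue t) ⟩
    (k + t % d) % d              ≡⟨ %-distribˡ-+ k (t % d) d ⟩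
    (k % d + t % d % d) % d      ≡⟨ cong (λ x → (k % d + x) % d) (m%n%n≡m%n t d) ⟩
    (k % d + t % d) % d          ≡⟨ %-distribˡ-+ k t d ⟨
    (k + t) % d                  ∎)
    where open ≡-Reasoning

  sucᶜ-residue : ∀ t → sucᶜ (residue t) ≡ residue (suc t)
  sucᶜ-residue t = begin
    sucᶜ (residue t)                     ≡⟨ residue-toℕ (sucᶜ (residue t)) ⟨
    residue (toℕ (sucᶜ (residue t)))     ≡⟨ cong residue (toℕ-sucᶜ (residue t)) ⟩
    residue (suc (toℕ (residue t)) % d)  ≡⟨ residue-% (suc (toℕ (residue t))) ⟩
    residue (1 + toℕ (residue t))        ≡⟨ residue-+-toℕ 1 t ⟩
    residue (suc t)                      ∎
    where open ≡-Reasoning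

  ∈-rotate : ∀ {j} {T : Subset d} → sucᶜ j ∈ T → j ∈ rotate T
  ∈-rotate {j} {T} sj∈T = lookup⇒[]= j (rotate T) (trans (lookup-rotate T j) ([]=⇒lookup sj∈T))

  ∈-rotate^ : ∀ m t {T : Subset d} → residue (t + m) ∈ T → residue t ∈ iterate rotate T m
  ∈-rotate^ zero    t {T} r∈T = subst (_∈ T) (cong residue (+-identityʳ t)) r∈T
  ∈-rotate^ (suc m) t {T} r∈T = ∈-rotate^ m t (∈-rotate (subst (_∈ T) t+m+1≡ r∈T))
    where t+m+1≡ = sym (trans (sucᶜ-residue (t + m)) (cong residue (sym (+-suc t m))))

  rotate^-≢ : ∀ m t {A : Subset d} → residue (t + m) ∈ A → residue t ∉ A → iterate rotate A m ≢ A
  rotate^-≢ m t {A} t+m∈A t∉A eq = t∉A (subst (residue t ∈_) eq (∈-rotate^ m t t+m∈A))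

  predᶜ : Fin d → Fin d
  predᶜ j = residue (n + toℕ j)

  sucᶜ-predᶜ : ∀ j → sucᶜ (predᶜ j) ≡ j
  sucᶜ-predᶜ j = begin
    sucᶜ (residue (n + toℕ j))  ≡⟨ sucᶜ-residue (n + toℕ j) ⟩
    residue (d + toℕ j)         ≡⟨ residue-d+ (toℕ j) ⟩
    residue (toℕ j)             ≡⟨ residue-toℕ j ⟩
    j                           ∎
    where open ≡-Reasoning

  ∈-rotate-predᶜ : ∀ {i} {T : Subset d} → i ∈ T → predᶜ i ∈ rotate T
  ∈-rotate-predᶜ {i} {T} i∈T = ∈-rotate (subst (_∈ T) (sym (sucᶜ-predᶜ i)) i∈T)

  predᶜ-residue : ∀ t → predᶜ (residue (suc t)) ≡ residue t
  predᶜ-residue t = begin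
    residue (n + toℕ (residue (suc t)))  ≡⟨ residue-+-toℕ n (suc t) ⟩
    residue (n + suc t)                  ≡⟨ cong residue (+-suc n t) ⟩
    residue (d + t)                      ≡⟨ residue-d+ t ⟩
    residue t                            ∎
    where open ≡-Reasoning

  predᶜ^-residue : ∀ u m → iterate predᶜ (residue (u + m)) u ≡ residue m
  predᶜ^-residue zero    m = refl
  predᶜ^-residue (suc u) m =
    trans (cong (λ j → iterate predᶜ j u) (predᶜ-residue (u + m))) (predᶜ^-residue u m)

module Enumerations (n : ℕ) where

  open Modulo n

  -- Rotating T by (d - i) + x moves x ∈ T onto i.
  entry : Fin d → Subset d → ℕ
  entry i T with nonempty? T
  ... | yes (x , _) = (d ∸ toℕ i) + toℕ x
  ... | no  _       = 0

  ∈-rotate^entry : ∀ i T → Nonempty T → i ∈ iterate rotate T (entry i T)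
  ∈-rotate^entry i T nonempty with nonempty? T
  ... | no empty      = contradiction nonempty empty
  ... | yes (x , x∈T) = subst (_∈ iterate rotate T ((d ∸ toℕ i) + toℕ x)) (residue-toℕ i)
                              (∈-rotate^ ((d ∸ toℕ i) + toℕ x) (toℕ i) (subst (_∈ T) (sym lands) x∈T))
    where
      lands : residue (toℕ i + ((d ∸ toℕ i) + toℕ x)) ≡ x
      lands = begin
        residue (toℕ i + ((d ∸ toℕ i) + toℕ x))  ≡⟨ cong residue (+-assoc (toℕ i) _ (toℕ x)) ⟨
        residue (toℕ i + (d ∸ toℕ i) + toℕ x)
          ≡⟨ cong (λ k → residue (k + toℕ x)) (m+[n∸m]≡n (<⇒≤ (toℕ<n i))) ⟩
        residue (d + toℕ x)                      ≡⟨ residue-d+ (toℕ x) ⟩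
        residue (toℕ x)                          ≡⟨ residue-toℕ x ⟩
        x                                        ∎
        where open ≡-Reasoning

  open OrbitWalk (≡-dec _≟ᵇ_) rotate rotate-injective predᶜ (λ i T → i ∈ T) ∈-rotate-predᶜ
                 Nonempty entry ∈-rotate^entry

  Descending : List (Subset d) → Set
  Descending = AllPairs (λ S T → ∣ T ∣ ≤ ∣ S ∣)

  -- L is S read backwards: when i is the residue of N - 1, entry t contains the residue of N - 1 - t.
  record DescendingEnumeration (i : Fin d) (l : ℕ) (L : List (Subset d)) : Set where
    field
      enumeration : Enumeration i (nonemptySubsetsUpTo l d) L
      descending  : Descending L
    open Enumeration enumeration public

  subsetsOfSize-closed : ∀ k → Closed (subsetsOfSize k d)
  subsetsOfSize-closed k {T} T∈ = ∈-subsetsOfSize⁺ (trans (∣rotate∣ T) (∈-subsetsOfSize⁻ k d T∈))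

  subsetsOfSize-nonempty : ∀ k → All Nonempty (subsetsOfSize (suc k) d)
  subsetsOfSize-nonempty k =
    All.tabulate λ T∈ → ∣p∣>0⇒Nonempty (subst (0 <_) (sym (∈-subsetsOfSize⁻ (suc k) d T∈)) 0<1+n)

  block : ∀ i k → Enumeration i (subsetsOfSize (suc k) d) (enumerate i (subsetsOfSize (suc k) d))
  block i k =
    enumerate-enumerates (subsetsOfSize-unique (suc k) d) (subsetsOfSize-nonempty k) (subsetsOfSize-closed (suc k))

  ⊤-block : ∀ i → Enumeration i (subsetsOfSize d d) [ ⊤ ]
  ⊤-block i = record { perm = ↭-reflexive (sym (subsetsOfSize-full d)) ; chain = ∈⊤ ∷ [] }

  []-descending : ∀ i → DescendingEnumeration i 0 []
  []-descending i = record { enumeration = []-enumeration refl ; descending = [] }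

  ++-descending : ∀ {i k B L} → Enumeration i (subsetsOfSize (suc k) d) B →
                  DescendingEnumeration (iterate predᶜ i (length B)) k L →
                  DescendingEnumeration i (suc k) (B ++ L)
  ++-descending {k = k} eB eL = record
    { enumeration = ++-enumeration eB (DescendingEnumeration.enumeration eL)
    ; descending  = AllPairs.++⁺ (AllPairs-fromAll (λ ∣S∣≡ ∣T∣≡ → ≤-reflexive (trans ∣T∣≡ (sym ∣S∣≡))) sizesB)
                                 (DescendingEnumeration.descending eL)
                                 (All.map (λ ∣S∣≡ → All.map (smaller ∣S∣≡) sizesL) sizesB)
    }
    where
      smaller : ∀ {s t} → s ≡ suc k → t ≤ k → t ≤ s
      smaller s≡ t≤k = ≤-trans (m≤n⇒m≤1+n t≤k) (≤-reflexive (sym s≡))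
      sizesB = All-enumeration (∈-subsetsOfSize⁻ (suc k) d) eB
      sizesL = All-enumeration (proj₂ ∘ ∈-nonemptySubsetsUpTo⁻ k) (DescendingEnumeration.enumeration eL)

  descendingEnumeration : ∀ l i → ∃[ L ] DescendingEnumeration i l L
  descendingEnumeration zero    i = [] , []-descending i
  descendingEnumeration (suc k) i = let L , eL = descendingEnumeration k _ in _ , ++-descending (block i k) eL

  BeginsWithRotations : ℕ → Subset d → List (Subset d) → Set
  BeginsWithRotations q A L = ∀ p → toℕ p ≤ q → lookup L p ≡ iterate rotate A (toℕ p)

  descendingEnumerationFrom : ∀ {l} i A → ∣ A ∣ ≡ l → i ∈ A →
                              ∀ q → (∀ {t} → t < q → iterate rotate A (suc t) ≢ A) →
                              ∃[ L ] DescendingEnumeration i l L × BeginsWithRotations q A L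
  descendingEnumerationFrom {zero}  i A ∣A∣≡0 i∈A _ _ =
    contradiction ∣A∣≡0 (>⇒≢ (Nonempty⇒∣p∣>0 (i , i∈A)))
  descendingEnumerationFrom {suc k} i A ∣A∣≡l i∈A q aperiodic =
    let ys , B≡ = enumerateFrom-prefix q unique closed A∈R aperiodic
        L , eL  = descendingEnumeration k (iterate predᶜ i (length B))
    in B ++ L , ++-descending (enumerateFrom-enumerates unique (subsetsOfSize-nonempty k) closed A∈R i∈A) eL ,
       λ p p≤q → lookup-iterate-++ rotate A (suc q) (ys ++ L) (trans (cong (_++ L) B≡) (++-assoc _ ys L))
                                   p (s≤s p≤q)
    where
      unique = subsetsOfSize-unique (suc k) d
      closed = subsetsOfSize-closed (suc k)
      A∈R = ∈-subsetsOfSize⁺ ∣A∣≡l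
      B = enumerateFrom i A (subsetsOfSize (suc k) d)

  PrefixContains : ℕ → ℕ → List (Subset d) → Set
  PrefixContains q c L = ∀ j (p : Fin (length L)) → j + toℕ p ≡ q → residue (j + c) ∈ lookup L p

  -- R_j = S_{N-r+j} is the entry of L at position r - 1 - j.
  LastSetsContain : ℕ → List (Subset d) → Set
  LastSetsContain r = PrefixContains (pred r) r

  LastSetsEnumeration : ℕ → ℕ → Set
  LastSetsEnumeration l r = ∃[ L ] DescendingEnumeration (residue (N d l ∸ 1)) l L × LastSetsContain r L

  PrefixContains-rotations : ∀ {q c A L} → BeginsWithRotations q A L →
                             (∀ j u → j + u ≡ q → residue (j + c + u) ∈ A) → PrefixContains q c L
  PrefixContains-rotations {c = c} rotations contains j p j+p≡q =
    subst (residue (j + c) ∈_) (sym (rotations p (subst (toℕ p ≤_) j+p≡q (m≤n+m (toℕ p) j))))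
      (∈-rotate^ (toℕ p) (j + c) (contains j (toℕ p) j+p≡q))

  PrefixContains-⊤∷ : ∀ {q c L} → PrefixContains q c L → PrefixContains (suc q) c (⊤ ∷ L)
  PrefixContains-⊤∷ contains j zero    _   = ∈⊤
  PrefixContains-⊤∷ contains j (suc p) eq = contains j p (suc-injective (trans (sym (+-suc j (toℕ p))) eq))

  module Ordering {l L} (E : DescendingEnumeration (residue (N d l ∸ 1)) l L) where

    open DescendingEnumeration E

    length-L : length L ≡ N d l
    length-L = trans (↭-length perm) (length-nonemptySubsetsUpTo l d)

    position : Fin (N d l) → Fin (length L)
    position i = cast (sym length-L) (opposite i)

    toℕ-position : ∀ i → toℕ (position i) ≡ N d l ∸ suc (toℕ i)
    toℕ-position i = trans (toℕ-cast _ (opposite i)) (opposite-prop i)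

    position-injective : ∀ {i j} → position i ≡ position j → i ≡ j
    position-injective {i} {j} eq = begin
      i                                     ≡⟨ opposite-involutive i ⟨
      opposite (opposite i)                 ≡⟨ cong opposite (cast-cast (opposite i)) ⟨
      opposite (cast length-L (position i)) ≡⟨ cong (opposite ∘ cast length-L) eq ⟩
      opposite (cast length-L (position j)) ≡⟨ cong opposite (cast-cast (opposite j)) ⟩
      opposite (opposite j)                 ≡⟨ opposite-involutive j ⟩
      j                                     ∎
      where
        open ≡-Reasoning
        cast-cast : ∀ k → cast length-L (cast (sym length-L) k) ≡ k
        cast-cast = cast-involutive length-L (sym length-L)

    position-surjective : ∀ k → position (opposite (cast length-L k)) ≡ k
    position-surjective k = trans (cong (cast (sym length-L)) (opposite-involutive (cast length-L k)))
                                  (cast-involutive (sym length-L) length-L k)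

    S : Fin (N d l) → Subset d
    S i = lookup L (position i)

    S-injective : ∀ i j → S i ≡ S j → i ≡ j
    S-injective i j eq = position-injective (Unique-lookup-injective unique eq)
      where unique = Unique-resp-↭ (setoid _) (↭⇒↭ₛ (↭-sym perm)) (nonemptySubsetsUpTo-unique l d)

    S-size : ∀ i → Nonempty (S i) × ∣ S i ∣ ≤ l
    S-size i = map₁ ∣p∣>0⇒Nonempty (∈-nonemptySubsetsUpTo⁻ l (∈-resp-↭ perm (∈-lookup (position i))))

    S-surjective : ∀ T → Nonempty T → ∣ T ∣ ≤ l → ∃[ i ] S i ≡ T
    S-surjective T nonempty ∣T∣≤l =
      opposite (cast length-L k) , trans (cong (lookup L) (position-surjective k)) (sym (lookup-index T∈L))
      where
        T∈L = ∈-resp-↭ (↭-sym perm) (∈-nonemptySubsetsUpTo⁺ l (Nonempty⇒∣p∣>0 nonempty) ∣T∣≤l)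
        k = index T∈L

    S-residue : ∀ i j → toℕ i % d ≡ toℕ j → j ∈ S i
    S-residue i j eq = subst (_∈ S i) phase (Chain-lookup chain (position i))
      where
        open ≡-Reasoning
        i₀ = residue (N d l ∸ 1)
        u  = N d l ∸ suc (toℕ i)
        phase : iterate predᶜ i₀ (toℕ (position i)) ≡ j
        phase = begin
          iterate predᶜ i₀ (toℕ (position i))    ≡⟨ cong (iterate predᶜ i₀) (toℕ-position i) ⟩
          iterate predᶜ i₀ u
            ≡⟨ cong (λ t → iterate predᶜ (residue t) u) (pred≡∸suc+ (toℕ<n i)) ⟩
          iterate predᶜ (residue (u + toℕ i)) u  ≡⟨ predᶜ^-residue u (toℕ i) ⟩
          residue (toℕ i)                        ≡⟨ toℕ-injective (trans (toℕ-residue (toℕ i)) eq) ⟩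
          j                                      ∎

    S-monotone : ∀ i j → toℕ i ≤ toℕ j → ∣ S i ∣ ≤ ∣ S j ∣
    S-monotone i j i≤j = AllPairs-lookup-≤ ≤-refl descending
      (subst₂ _≤_ (sym (toℕ-position j)) (sym (toℕ-position i)) (∸-monoʳ-≤ (N d l) (s≤s i≤j)))

    S-last : ∀ {r} → N d l % d ≡ r → LastSetsContain r L →
             ∀ j i (k : Fin d) → j < r → toℕ i ≡ N d l ∸ r + j → toℕ k ≡ j + r → k ∈ S i
    S-last {r} N%d≡r last j i k j<r i≡ k≡ =
      subst (_∈ S i) (trans (cong residue (sym k≡)) (residue-toℕ k)) (last j (position i) offset)
      where
        open ≡-Reasoning
        r≤N = subst (_≤ N d l) N%d≡r (m%n≤m (N d l) d)
        offset : j + toℕ (position i) ≡ pred r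
        offset = begin
          j + toℕ (position i)               ≡⟨ cong (j +_) (toℕ-position i) ⟩
          j + (N d l ∸ suc (toℕ i))          ≡⟨ cong (λ t → j + (N d l ∸ suc t)) i≡ ⟩
          j + (N d l ∸ suc (N d l ∸ r + j))  ≡⟨ cong (j +_) (m∸[1+[m∸n]+o]≡n∸[1+o] j r≤N) ⟩
          j + (r ∸ suc j)                    ≡⟨ cong pred (m+[n∸m]≡n j<r) ⟩
          pred r                             ∎

  -- Rotating A₀ by m = d - r moves 0 ∈ A₀ onto the residue r of N - 1, the phase of the first entry,
  -- and moves r + 1 ∈ A₀ onto e_{j+r+1} in the entry at position r - j.
  lastSets-rotation : ∀ k r A₀ → N d (suc k) % d ≡ suc r → suc r < d → ∣ A₀ ∣ ≡ suc k →
                      residue 0 ∈ A₀ → residue (suc r) ∈ A₀ →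
                      (∀ {t} → t < r → iterate rotate A₀ (suc t) ≢ A₀) →
                      LastSetsEnumeration (suc k) (suc r)
  lastSets-rotation k r A₀ N%d≡r r<d ∣A₀∣≡ 0∈A₀ r∈A₀ A₀-aperiodic =
    let L , E , rotations = descendingEnumerationFrom _ Aₘ (trans (∣rotate^∣ m A₀) ∣A₀∣≡) i₀∈Aₘ r
                              aperiodic
    in L , E , PrefixContains-rotations rotations λ j u j+u≡r →
                 ∈-rotate^ m (j + suc r + u) (subst (_∈ A₀) (sym (lands j u j+u≡r)) r∈A₀)
    where
      open ≡-Reasoning
      m = d ∸ r
      r+m≡d : r + m ≡ d
      r+m≡d = m+[n∸m]≡n (<⇒≤ (<-trans (n<1+n r) r<d))
      Aₘ = iterate rotate A₀ m
      i₀∈Aₘ : residue (N d (suc k) ∸ 1) ∈ Aₘ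
      i₀∈Aₘ = subst (_∈ Aₘ) (sym (residue-∸ (N d (suc k)) 1 N%d≡r (s≤s z≤n)))
        (∈-rotate^ m r (subst (_∈ A₀) (sym (trans (cong residue r+m≡d+0) (residue-d+ 0))) 0∈A₀))
        where r+m≡d+0 = trans r+m≡d (sym (+-identityʳ d))
      aperiodic : ∀ {t} → t < r → iterate rotate Aₘ (suc t) ≢ Aₘ
      aperiodic {t} t<r eq =
        A₀-aperiodic t<r (iterate-injective rotate-injective m (trans (iterate-comm rotate A₀ (suc t) m) eq))
      lands : ∀ j u → j + u ≡ r → residue (j + suc r + u + m) ≡ residue (suc r)
      lands j u j+u≡r = begin
        residue (j + suc r + u + m)  ≡⟨ cong residue (rearrange j (suc r) u m) ⟩
        residue (j + u + m + suc r)  ≡⟨ cong (λ x → residue (x + m + suc r)) j+u≡r ⟩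
        residue (r + m + suc r)      ≡⟨ cong (λ x → residue (x + suc r)) r+m≡d ⟩
        residue (d + suc r)          ≡⟨ residue-d+ (suc r) ⟩
        residue (suc r)              ∎
        where rearrange : ∀ a b c e → a + b + c + e ≡ a + c + e + b
              rearrange = solve-∀

  interval-aperiodic : ∀ {w t} → w ≤ n → t < w → iterate rotate (interval 0 w) (suc t) ≢ interval 0 w
  interval-aperiodic {w} {t} w≤n t<w = rotate^-≢ (suc t) n
    (subst (_∈ interval 0 w) (sym (trans (cong residue (+-suc n t)) (residue-d+ t)))
      (residue∈interval t z≤n t<w (<-≤-trans t<w (m≤n⇒m≤1+n w≤n))))
    (residue∉interval n (inj₂ w≤n) (n<1+n n))

  lastSets-interval : ∀ k r → N d (suc k) % d ≡ suc r → suc r < suc k → suc k < d →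
                      LastSetsEnumeration (suc k) (suc r)
  lastSets-interval k r N%d≡r r<l l<d =
    lastSets-rotation k r (interval 0 (suc k)) N%d≡r (<-trans r<l l<d) (∣interval∣ 0 (suc k) (<⇒≤ l<d))
      (residue∈interval 0 z≤n (s≤s z≤n) (s≤s z≤n)) (residue∈interval (suc r) z≤n r<l (<-trans r<l l<d))
      (λ t<r → interval-aperiodic (s≤s⁻¹ l<d) (<-trans t<r (<-trans (n<1+n r) r<l)))

  -- A₀ = {0} ∪ {r + 1, ..., r + k + 1}: once r + 1 ≥ l, no interval of length l contains both 0 and r + 1.
  lastSets-pointInterval : ∀ k r → N d (suc (suc k)) % d ≡ suc r → suc k ≤ r → suc r + suc r ≤ d →
                           LastSetsEnumeration (suc (suc k)) (suc r)
  lastSets-pointInterval k r N%d≡r l≤r 2r≤d =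
    lastSets-rotation (suc k) r A₀ N%d≡r (s≤s r<n) (cong suc (∣interval∣ r (suc k) r+l≤n))
      0∈A₀ r∈A₀ aperiodic
    where
      A₀ : Subset d
      A₀ = inside ∷ interval r (suc k)
      r+l≤n : r + suc k ≤ n
      r+l≤n = ≤-trans (+-monoʳ-≤ r (m≤n⇒m≤1+n l≤r)) (s≤s⁻¹ 2r≤d)
      r<n : r < n
      r<n = <-≤-trans (m<m+n r (s≤s z≤n)) (s≤s⁻¹ 2r≤d)
      0∈A₀ : residue 0 ∈ A₀
      0∈A₀ = subst (_∈ A₀) (sym (toℕ-injective (toℕ-residue 0))) here
      r∈A₀ : residue (suc r) ∈ A₀
      r∈A₀ = subst (_∈ A₀) (sym (residue-suc r<n)) (there (∈-interval _ r≤ <r+l))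
        where
          r≤  = ≤-reflexive (sym (toℕ-fromℕ< r<n))
          <r+l = subst (_< r + suc k) (sym (toℕ-fromℕ< r<n)) (m<m+n r (s≤s z≤n))
      aperiodic : ∀ {t} → t < r → iterate rotate A₀ (suc t) ≢ A₀
      aperiodic {t} t<r = rotate^-≢ (suc t) (suc t′)
          (subst (_∈ A₀) (cong (residue ∘ suc) (sym (m∸n+n≡m t<r))) r∈A₀)
          (λ t′∈A₀ → t′∉A₀ (subst (_∈ A₀) (residue-suc t′<n) t′∈A₀))
        where
          t′ = r ∸ suc t
          t′<r : t′ < r
          t′<r = ∸-monoʳ-< (s≤s z≤n) t<r
          t′<n : t′ < n
          t′<n = <-trans t′<r r<n
          t′∉A₀ : suc (fromℕ< t′<n) ∉ A₀
          t′∉A₀ (there t′∈) = ∉-interval _ (inj₁ (subst (_< r) (sym (toℕ-fromℕ< t′<n)) t′<r))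
                                          t′∈

  lastSets-full : ∀ r → N d d % d ≡ r → 0 < r → r + r ≤ d → LastSetsEnumeration d r
  lastSets-full (suc zero) _ _ _ =
    let L , E = descendingEnumeration n _
    in ⊤ ∷ L , ++-descending (⊤-block _) E , λ where
         j zero    _        → ∈⊤
         j (suc p) j+p+1≡0 → contradiction (trans (sym (+-suc j _)) j+p+1≡0) 1+n≢0
  lastSets-full (suc (suc s)) N%d≡r _ 2r≤d =
    let L , E , rotations = descendingEnumerationFrom _ (interval 0 n) (∣interval∣ 0 n (n≤1+n n)) i₁∈A s
                              (λ t<s → interval-aperiodic ≤-refl (<-trans t<s s<n))
    in ⊤ ∷ L , ++-descending (⊤-block _) E , PrefixContains-⊤∷ (PrefixContains-rotations {L = L} rotations
         λ j u j+u≡s → let <n = subst (_< n) (sym (lands j u j+u≡s)) 2s+2<n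
                       in residue∈interval _ z≤n <n (<-trans <n (n<1+n n)))
    where
      2s+2<n : s + suc (suc s) < n
      2s+2<n = s≤s⁻¹ 2r≤d
      s<n : s < n
      s<n = <-≤-trans (m<m+n s (s≤s z≤n)) (<⇒≤ 2s+2<n)
      i₁∈A : predᶜ (residue (N d d ∸ 1)) ∈ interval 0 n
      i₁∈A = subst (_∈ interval 0 n) (sym i₁≡s) (residue∈interval s z≤n s<n (<-trans s<n (n<1+n n)))
        where i₁≡s = trans (cong predᶜ (residue-∸ (N d d) 1 N%d≡r (s≤s z≤n))) (predᶜ-residue s)
      lands : ∀ j u → j + u ≡ s → j + suc (suc s) + u ≡ s + suc (suc s)
      lands j u j+u≡s = trans (rearrange j (suc (suc s)) u) (cong (_+ suc (suc s)) j+u≡s)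
        where rearrange : ∀ a b c → a + b + c ≡ a + c + b
              rearrange = solve-∀

  lastSetsEnumeration : ∀ l r → 1 ≤ l → l ≤ d → N d l % d ≡ r → 1 ≤ r → 2 * r ≤ d →
                        LastSetsEnumeration l r
  lastSetsEnumeration l r 1≤l l≤d N%d≡r 1≤r 2r≤d with m≤n⇒m<n∨m≡n l≤d
  ... | inj₂ refl = lastSets-full r N%d≡r 1≤r (subst (_≤ d) (cong (r +_) (+-identityʳ r)) 2r≤d)
  lastSetsEnumeration (suc zero) r _ _ N%d≡r 1≤r _ | inj₁ _ =
    contradiction (trans (sym N%d≡r) (trans (cong (_% d) (nC1≡n d)) (n%n≡0 d))) (>⇒≢ 1≤r)
  lastSetsEnumeration (suc (suc k)) (suc r) _ _ N%d≡r _ 2r≤d | inj₁ l<d with suc r <? suc (suc k)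
  ... | yes r<l = lastSets-interval (suc k) r N%d≡r r<l l<d
  ... | no  r≮l = lastSets-pointInterval k r N%d≡r (s≤s⁻¹ (≮⇒≥ r≮l))
                    (subst (_≤ d) (cong (suc r +_) (+-identityʳ (suc r))) 2r≤d)

lemma7p6 : (d l r : ℕ) → .{{_ : NonZero d}} → 1 ≤ l → l ≤ d →
    N d l % d ≡ r → 1 ≤ r → 2 * r ≤ d →
    Σ (Fin (N d l) → Subset d) λ S →
      ((i j : Fin (N d l)) → S i ≡ S j → i ≡ j) ×
      ((i : Fin (N d l)) → Nonempty (S i) × ∣ S i ∣ ≤ l) ×
      ((T : Subset d) → Nonempty T → ∣ T ∣ ≤ l → ∃ λ i → S i ≡ T) ×
      ((i : Fin (N d l)) (j : Fin d) → toℕ i % d ≡ toℕ j → j ∈ S i) ×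
      ((i j : Fin (N d l)) → toℕ i ≤ toℕ j → ∣ S i ∣ ≤ ∣ S j ∣) ×
      ((j : ℕ) (i : Fin (N d l)) (k : Fin d) → j < r →
        toℕ i ≡ N d l ∸ r + j → toℕ k ≡ j + r → k ∈ S i)
lemma7p6 (suc n) l r 1≤l l≤d N%d≡r 1≤r 2r≤d =
  let L , E , last = lastSetsEnumeration l r 1≤l l≤d N%d≡r 1≤r 2r≤d
      open Ordering E
  in S , S-injective , S-size , S-surjective , S-residue , S-monotone , S-last N%d≡r last
  where open Enumerations n
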